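{- For all $n\geq 2$, in terms of Pell-Lucas numbers $Q_k$: $$B_{n}^{neobc}=\frac{36Q_{4n-4}+15Q_{4n-5}+6}{8},\quad C_{n}^{neobc}=\frac{51Q_{4n-4}+21Q_{4n-5}}{4},$$ $$R_{n}^{neobc}=\frac{15Q_{4n-4}+6Q_{4n-5}-10}{8},\quad CR_{n}^{neobc}=\frac{21Q_{4n-4}+9Q_{4n-5}}{8}.$$
   Context: Pell-Lucas numbers: $Q_0=Q_1=2$, $Q_k=2Q_{k-1}+Q_{k-2}$. A positive integer $m$ is a neo balcobalancing number if there is a positive integer $r$ (its neo balcobalancer) such that $(1+2+\cdots+(m-1))+(1+2+\cdots+m)=2[(m-1)+m+(m+1)+(m+2)+\cdots+(m+r)]$; then $r=\frac{ -2m-1+\sqrt{8m^2-12m+9}}{2}$ (equivalently, $m$ is a neo balcobalancing number iff $8m^2-12m+9$ is a perfect square). $B_n^{neobc}$ denotes the $n$-th neo balcobalancing number in increasing order ($n\ge1$), $R_n^{neobc}$ its neo balcobalancer, $C_n^{neobc}=\sqrt{8(B_n^{neobc})^2-12B_n^{neobc}+9}$ and $CR_n^{neobc}=\sqrt{2(R_n^{neobc})^2+5R_n^{neobc}+2}$. -}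

module Defs where

open import Data.Nat using (ℕ; zero; suc; _+_; _*_; _∸_; _≤_; _<_)
open import Data.Product using (_×_; ∃; ∃-syntax)
open import Relation.Binary.PropositionalEquality using (_≡_)
open import Function.Bundles using (_⇔_)

Q : ℕ → ℕ
Q zero = 2
Q (suc zero) = 2
Q (suc (suc k)) = 2 * Q (suc k) + Q k

tri : ℕ → ℕ
tri zero = 0
tri (suc k) = suc k + tri k

rangeSum : ℕ → ℕ → ℕ
rangeSum a zero = 0
rangeSum a (suc len) = a + len + rangeSum a len

NeoEq : ℕ → ℕ → Set
NeoEq m r = tri (m ∸ 1) + tri m ≡ 2 * rangeSum (m ∸ 1) (r + 2)

IsNeoBalcobalancer : ℕ → ℕ → Set
IsNeoBalcobalancer m r = 1 ≤ m × 1 ≤ r × NeoEq m r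

IsNeoBalcobalancing : ℕ → Set
IsNeoBalcobalancing m = ∃[ r ] IsNeoBalcobalancer m r

StrictlyIncreasing : (ℕ → ℕ) → Set
StrictlyIncreasing f = ∀ i j → i < j → f i < f j

-- f enumerates the neo balcobalancing numbers in increasing order:
-- f 0 = B_1, f 1 = B_2, ...
EnumeratesNeo : (ℕ → ℕ) → Set
EnumeratesNeo f = StrictlyIncreasing f × (∀ m → IsNeoBalcobalancing m ⇔ (∃[ k ] f k ≡ m))

module Submission where

-- Put m = k + 1. Then 8m² - 12m + 9 = c² says (x, y) = (4k + 1, c) solves the Pell-type
-- equation x² + 9 = 2y², so the square of its automorphism (x, y) ↦ (3x + 4y, 2x + 3y),
-- which preserves x mod 4, maps neo balcobalancing numbers to neo balcobalancing numbers.
-- Its inverse strictly decreases k as long as k ≥ 18, and below that bound a finite search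
-- leaves only (k, c) = (5, 15); so by descent the neo balcobalancing numbers, their
-- balcobalancers and C, CR values are the orbit of (6, 1, 15, 3) under a linear recurrence.
-- The recurrence has the matrix [[29, 12], [12, 5]] that also sends (Q (4t+3), Q (4t+2))
-- to (Q (4t+7), Q (4t+6)), which gives 8B = 3 Q (4n-1) + 6, 8R + 10 = 3 Q (4n-2),
-- 4C = 3 Q (4n-2) + 3 Q (4n-1) and 8 CR = 3 Q (4n-3) + 3 Q (4n-2); the paper's formulas
-- are these rewritten with the Pell-Lucas recurrence.

open import Defs
open import Data.Nat using (ℕ; zero; suc; _+_; _*_; _∸_; _≤_; _<_; _≟_; _≤?_; z≤n; s≤s; z<s)
open import Data.Nat.Properties
open import Data.Nat.Induction using (<-wellFounded)
open import Data.Nat.Tactic.RingSolver using (solve-∀)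
open import Data.Fin using (Fin; toℕ; fromℕ<)
open import Data.Fin.Properties using (all?; toℕ-fromℕ<)
open import Data.Product using (_×_; _,_; proj₁; proj₂; map₂; ∃; ∃-syntax; ∃₂)
open import Data.Sum using (inj₁; inj₂)
open import Function.Bundles using (_⇔_; mk⇔; Equivalence)
open import Function.Definitions using (Injective)
open import Induction.WellFounded using (Acc; acc)
open import Relation.Nullary using (yes; no)
open import Relation.Nullary.Decidable using (toWitness; _→-dec_; _×-dec_)
open import Relation.Binary.PropositionalEquality
  using (_≡_; refl; sym; trans; cong; cong₂; subst; subst₂; module ≡-Reasoning)

+-transfer : ∀ {a b c d} → a + d ≡ b + c → a ≡ b ⇔ c ≡ d
+-transfer {a} {b} {c} {d} e = mk⇔
  (λ a≡b → sym (+-cancelˡ-≡ b d c (trans (cong (_+ d) (sym a≡b)) e)))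
  (λ c≡d → +-cancelʳ-≡ d a b (trans e (cong (b +_) c≡d)))

m*m<n*n⇒m<n : ∀ {m n} → m * m < n * n → m < n
m*m<n*n⇒m<n lt = ≰⇒> λ n≤m → <⇒≱ lt (*-mono-≤ n≤m n≤m)

m*m≤n*n⇒m≤n : ∀ {m n} → m * m ≤ n * n → m ≤ n
m*m≤n*n⇒m≤n le = ≮⇒≥ λ n<m → ≤⇒≯ le (*-mono-< n<m n<m)

m*m≡n*n⇒m≡n : ∀ {m n} → m * m ≡ n * n → m ≡ n
m*m≡n*n⇒m≡n e = ≤-antisym (m*m≤n*n⇒m≤n (≤-reflexive e)) (m*m≤n*n⇒m≤n (≤-reflexive (sym e)))

step⇒strictlyIncreasing : ∀ {f : ℕ → ℕ} → (∀ i → f i < f (suc i)) → StrictlyIncreasing f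
step⇒strictlyIncreasing f< i (suc j) i<1+j with m≤n⇒m<n∨m≡n (≤-pred i<1+j)
... | inj₁ i<j = <-trans (step⇒strictlyIncreasing f< i j i<j) (f< j)
... | inj₂ refl = f< i

module _ {f : ℕ → ℕ} (f↑ : StrictlyIncreasing f) where

  strictlyIncreasing⇒monotone : ∀ {i j} → i ≤ j → f i ≤ f j
  strictlyIncreasing⇒monotone i≤j with m≤n⇒m<n∨m≡n i≤j
  ... | inj₁ i<j = <⇒≤ (f↑ _ _ i<j)
  ... | inj₂ refl = ≤-refl

  strictlyIncreasing⇒reflects-< : ∀ {i j} → f i < f j → i < j
  strictlyIncreasing⇒reflects-< fi<fj = ≰⇒> λ j≤i → <⇒≱ fi<fj (strictlyIncreasing⇒monotone j≤i)

  strictlyIncreasing⇒injective : Injective _≡_ _≡_ f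
  strictlyIncreasing⇒injective {i} {j} fi≡fj = ≤-antisym
    (≮⇒≥ λ j<i → <⇒≢ (f↑ j i j<i) (sym fi≡fj))
    (≮⇒≥ λ i<j → <⇒≢ (f↑ i j i<j) fi≡fj)

enumeration-≤ : ∀ {f g : ℕ → ℕ} → StrictlyIncreasing f → StrictlyIncreasing g →
                (∀ i → ∃[ j ] g i ≡ f j) → ∀ i → f i ≤ g i
enumeration-≤ f↑ g↑ g⊆f zero with g⊆f zero
... | j , g0≡fj = ≤-trans (strictlyIncreasing⇒monotone f↑ z≤n) (≤-reflexive (sym g0≡fj))
enumeration-≤ f↑ g↑ g⊆f (suc i) with g⊆f (suc i)
... | j , g[1+i]≡fj = ≤-trans (strictlyIncreasing⇒monotone f↑ i<j) (≤-reflexive (sym g[1+i]≡fj))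
  where
  i<j : i < j
  i<j = strictlyIncreasing⇒reflects-< f↑
          (≤-<-trans (enumeration-≤ f↑ g↑ g⊆f i)
                     (<-≤-trans (g↑ i (suc i) ≤-refl) (≤-reflexive g[1+i]≡fj)))

same-image⇒≗ : ∀ {f g : ℕ → ℕ} → StrictlyIncreasing f → StrictlyIncreasing g →
               (∀ i → ∃[ j ] f i ≡ g j) → (∀ i → ∃[ j ] g i ≡ f j) → ∀ i → f i ≡ g i
same-image⇒≗ f↑ g↑ f⊆g g⊆f i = ≤-antisym (enumeration-≤ f↑ g↑ g⊆f i) (enumeration-≤ g↑ f↑ f⊆g i)

tri+tri-suc : ∀ k → tri k + tri (suc k) ≡ suc k * suc k
tri+tri-suc zero = refl
tri+tri-suc (suc k) = begin
    tri (suc k) + tri (suc (suc k))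
  ≡⟨ regroup k (tri k) ⟩
    (2 + k) + (1 + k) + (tri k + tri (suc k))
  ≡⟨ cong ((2 + k) + (1 + k) +_) (tri+tri-suc k) ⟩
    (2 + k) + (1 + k) + suc k * suc k
  ≡⟨ square-suc k ⟩
    suc (suc k) * suc (suc k) ∎
  where
  open ≡-Reasoning
  regroup : ∀ k s → (1 + k + s) + (2 + k + (1 + k + s)) ≡ (2 + k) + (1 + k) + (s + (1 + k + s))
  regroup = solve-∀
  square-suc : ∀ k → (2 + k) + (1 + k) + (1 + k) * (1 + k) ≡ (2 + k) * (2 + k)
  square-suc = solve-∀

2*rangeSum+len : ∀ a l → 2 * rangeSum a l + l ≡ l * (2 * a + l)
2*rangeSum+len a zero = refl
2*rangeSum+len a (suc l) = begin
    2 * (a + l + rangeSum a l) + suc l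
  ≡⟨ regroup a l (rangeSum a l) ⟩
    2 * a + 2 * l + 1 + (2 * rangeSum a l + l)
  ≡⟨ cong (2 * a + 2 * l + 1 +_) (2*rangeSum+len a l) ⟩
    2 * a + 2 * l + 1 + l * (2 * a + l)
  ≡⟨ expand a l ⟩
    suc l * (2 * a + suc l) ∎
  where
  open ≡-Reasoning
  regroup : ∀ a l s → 2 * (a + l + s) + (1 + l) ≡ 2 * a + 2 * l + 1 + (2 * s + l)
  regroup = solve-∀
  expand : ∀ a l → 2 * a + 2 * l + 1 + l * (2 * a + l) ≡ (1 + l) * (2 * a + (1 + l))
  expand = solve-∀

NeoSqrt : ℕ → ℕ → Set
NeoSqrt m c = c * c + 12 * m ≡ 8 * (m * m) + 9

NeoEq⇔quadratic : ∀ k l → NeoEq (suc k) l ⇔ ((l + 2) * (2 * k + (l + 2)) ≡ suc k * suc k + (l + 2))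
NeoEq⇔quadratic k l = mk⇔
  (λ e → sym (trans (cong (_+ (l + 2)) (trans (sym (tri+tri-suc k)) e)) (2*rangeSum+len k (l + 2))))
  (λ e → trans (tri+tri-suc k) (+-cancelʳ-≡ (l + 2) _ _ (trans (sym e) (sym (2*rangeSum+len k (l + 2))))))

-- With m = k + 1 and r = j + 1, the root is c = 2m + 2r + 1.
NeoEq⇔NeoSqrt : ∀ k j → NeoEq (suc k) (suc j) ⇔ NeoSqrt (suc k) (2 * k + 2 * j + 5)
NeoEq⇔NeoSqrt k j = mk⇔
  (λ e → Equivalence.from (+-transfer (identity k j))
           (cong (4 *_) (Equivalence.to (NeoEq⇔quadratic k (suc j)) e)))
  (λ h → Equivalence.from (NeoEq⇔quadratic k (suc j))
           (*-cancelˡ-≡ _ _ 4 (Equivalence.to (+-transfer (identity k j)) h)))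
  where
  identity : ∀ k j →
      ((2 * k + 2 * j + 5) * (2 * k + 2 * j + 5) + 12 * (1 + k)) + 4 * ((1 + k) * (1 + k) + ((1 + j) + 2))
    ≡ (8 * ((1 + k) * (1 + k)) + 9) + 4 * (((1 + j) + 2) * (2 * k + ((1 + j) + 2)))
  identity = solve-∀

NeoSqrt-unique : ∀ m c c′ → NeoSqrt m c → NeoSqrt m c′ → c ≡ c′
NeoSqrt-unique m c c′ h h′ = m*m≡n*n⇒m≡n {c} {c′} (+-cancelʳ-≡ (12 * m) _ _ (trans h (sym h′)))

NeoSqrt⇒square : ∀ k c → NeoSqrt (suc k) c → c * c ≡ 8 * (k * k) + 4 * k + 5
NeoSqrt⇒square k c h = +-cancelʳ-≡ (12 * suc k) _ _ (trans h (expand k))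
  where
  expand : ∀ k → 8 * ((1 + k) * (1 + k)) + 9 ≡ 8 * (k * k) + 4 * k + 5 + 12 * (1 + k)
  expand = solve-∀

-- Invariance of x² + 9 - 2y² under (x, y) ↦ (17x + 24y, 12x + 17y), for x = 4k + 1 and y = c.
NeoSqrt-step : ∀ k c → NeoSqrt (suc k) c ⇔ NeoSqrt (suc (17 * k + 6 * c + 4)) (48 * k + 17 * c + 12)
NeoSqrt-step k c = +-transfer (invariance k c)
  where
  invariance : ∀ k c →
      (c * c + 12 * (1 + k)) + (8 * ((1 + (17 * k + 6 * c + 4)) * (1 + (17 * k + 6 * c + 4))) + 9)
    ≡ (8 * ((1 + k) * (1 + k)) + 9)
      + ((48 * k + 17 * c + 12) * (48 * k + 17 * c + 12) + 12 * (1 + (17 * k + 6 * c + 4)))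
  invariance = solve-∀

-- The (t+1)-st neo balcobalancing number is K t + 1, its balcobalancer J t + 1,
-- and its C and CR values are C t and D t.
K J : ℕ → ℕ
K zero = 5
K (suc t) = 29 * K t + 12 * J t + 34
J zero = 0
J (suc t) = 12 * K t + 5 * J t + 12

B : ℕ → ℕ
B t = suc (K t)

C : ℕ → ℕ
C t = 2 * K t + 2 * J t + 5

D : ℕ → ℕ
D zero = 3
D (suc t) = 17 * D t + 24 * J t + 54

K-suc : ∀ t → K (suc t) ≡ 17 * K t + 6 * C t + 4
K-suc t = identity (K t) (J t)
  where
  identity : ∀ k j → 29 * k + 12 * j + 34 ≡ 17 * k + 6 * (2 * k + 2 * j + 5) + 4
  identity = solve-∀

C-suc : ∀ t → C (suc t) ≡ 48 * K t + 17 * C t + 12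
C-suc t = identity (K t) (J t)
  where
  identity : ∀ k j → 2 * (29 * k + 12 * j + 34) + 2 * (12 * k + 5 * j + 12) + 5
                   ≡ 48 * k + 17 * (2 * k + 2 * j + 5) + 12
  identity = solve-∀

K≡D+J+2 : ∀ t → K t ≡ D t + J t + 2
K≡D+J+2 zero = refl
K≡D+J+2 (suc t) = begin
    29 * K t + 12 * J t + 34
  ≡⟨ cong (λ k → 29 * k + 12 * J t + 34) (K≡D+J+2 t) ⟩
    29 * (D t + J t + 2) + 12 * J t + 34
  ≡⟨ identity (D t) (J t) ⟩
    17 * D t + 24 * J t + 54 + (12 * (D t + J t + 2) + 5 * J t + 12) + 2
  ≡⟨ cong (λ k → 17 * D t + 24 * J t + 54 + (12 * k + 5 * J t + 12) + 2) (sym (K≡D+J+2 t)) ⟩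
    D (suc t) + J (suc t) + 2 ∎
  where
  open ≡-Reasoning
  identity : ∀ d j → 29 * (d + j + 2) + 12 * j + 34 ≡ 17 * d + 24 * j + 54 + (12 * (d + j + 2) + 5 * j + 12) + 2
  identity = solve-∀

K-increasing : ∀ t → K t < K (suc t)
K-increasing t = subst (K t <_) (sym (identity (K t) (J t))) (m<m+n (K t) z<s)
  where
  identity : ∀ k j → 29 * k + 12 * j + 34 ≡ k + suc (28 * k + 12 * j + 33)
  identity = solve-∀

B-strictlyIncreasing : StrictlyIncreasing B
B-strictlyIncreasing = step⇒strictlyIncreasing λ t → s≤s (K-increasing t)

NeoSqrt-orbit : ∀ t → NeoSqrt (B t) (C t)
NeoSqrt-orbit zero = refl
NeoSqrt-orbit (suc t) = subst₂ (λ k c → NeoSqrt (suc k) c) (sym (K-suc t)) (sym (C-suc t))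
  (Equivalence.to (NeoSqrt-step (K t) (C t)) (NeoSqrt-orbit t))

OnOrbit : ℕ → ℕ → Set
OnOrbit k c = ∃[ t ] (k ≡ K t × c ≡ C t)

OnOrbit-step : ∀ {k c} → OnOrbit k c → OnOrbit (17 * k + 6 * c + 4) (48 * k + 17 * c + 12)
OnOrbit-step (t , refl , refl) = suc t , sym (K-suc t) , sym (C-suc t)

16k+4<6c : ∀ k c → c * c ≡ 8 * (k * k) + 4 * k + 5 → 16 * k + 4 < 6 * c
16k+4<6c k c sq = m*m<n*n⇒m<n (begin-strict
    (16 * k + 4) * (16 * k + 4)
  <⟨ m<m+n _ z<s ⟩
    (16 * k + 4) * (16 * k + 4) + suc (32 * (k * k) + 16 * k + 163)
  ≡⟨ identity k ⟩
    36 * (8 * (k * k) + 4 * k + 5)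
  ≡⟨ cong (36 *_) (sym sq) ⟩
    36 * (c * c)
  ≡⟨ square-scale c ⟩
    6 * c * (6 * c) ∎)
  where
  open ≤-Reasoning
  identity : ∀ k → (16 * k + 4) * (16 * k + 4) + suc (32 * (k * k) + 16 * k + 163)
                 ≡ 36 * (8 * (k * k) + 4 * k + 5)
  identity = solve-∀
  square-scale : ∀ c → 36 * (c * c) ≡ 6 * c * (6 * c)
  square-scale = solve-∀

48k+12≤17c : ∀ k c → c * c ≡ 8 * (k * k) + 4 * k + 5 → 48 * k + 12 ≤ 17 * c
48k+12≤17c k c sq = m*m≤n*n⇒m≤n (begin
    (48 * k + 12) * (48 * k + 12)
  ≤⟨ m≤m+n _ _ ⟩
    (48 * k + 12) * (48 * k + 12) + (8 * (k * k) + 4 * k + 1301)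
  ≡⟨ identity k ⟩
    289 * (8 * (k * k) + 4 * k + 5)
  ≡⟨ cong (289 *_) (sym sq) ⟩
    289 * (c * c)
  ≡⟨ square-scale c ⟩
    17 * c * (17 * c) ∎)
  where
  open ≤-Reasoning
  identity : ∀ k → (48 * k + 12) * (48 * k + 12) + (8 * (k * k) + 4 * k + 1301)
                 ≡ 289 * (8 * (k * k) + 4 * k + 5)
  identity = solve-∀
  square-scale : ∀ c → 289 * (c * c) ≡ 17 * c * (17 * c)
  square-scale = solve-∀

-- Writing k = i + 18 rather than 18 + i keeps k from unfolding into a tower of sucs.
6c≤17k+4 : ∀ k c → 18 ≤ k → c * c ≡ 8 * (k * k) + 4 * k + 5 → 6 * c ≤ 17 * k + 4
6c≤17k+4 k c 18≤k sq = m*m≤n*n⇒m≤n (begin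
    6 * c * (6 * c)
  ≤⟨ m≤m+n _ _ ⟩
    6 * c * (6 * c) + slack
  ≡⟨ cong (_+ slack) (square-scale c) ⟩
    36 * (c * c) + slack
  ≡⟨ cong (λ s → 36 * s + slack) sq ⟩
    36 * (8 * (k * k) + 4 * k + 5) + slack
  ≡⟨ cong (λ k → 36 * (8 * (k * k) + 4 * k + 5) + slack) (sym i+18≡k) ⟩
    36 * (8 * ((i + 18) * (i + 18)) + 4 * (i + 18) + 5) + slack
  ≡⟨ identity i ⟩
    (17 * (i + 18) + 4) * (17 * (i + 18) + 4)
  ≡⟨ cong (λ k → (17 * k + 4) * (17 * k + 4)) i+18≡k ⟩
    (17 * k + 4) * (17 * k + 4) ∎)
  where
  open ≤-Reasoning
  i = k ∸ 18
  i+18≡k : i + 18 ≡ k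
  i+18≡k = m∸n+n≡m 18≤k
  slack = i * i + 28 * i + 16
  square-scale : ∀ c → 6 * c * (6 * c) ≡ 36 * (c * c)
  square-scale = solve-∀
  identity : ∀ i → 36 * (8 * ((i + 18) * (i + 18)) + 4 * (i + 18) + 5) + (i * i + 28 * i + 16)
                 ≡ (17 * (i + 18) + 4) * (17 * (i + 18) + 4)
  identity = solve-∀

step-inverse : ∀ {k c k₀ c₀} → k₀ + 6 * c ≡ 17 * k + 4 → c₀ + (48 * k + 12) ≡ 17 * c →
               k ≡ 17 * k₀ + 6 * c₀ + 4 × c ≡ 48 * k₀ + 17 * c₀ + 12
step-inverse {k} {c} {k₀} {c₀} hk hc =
    Equivalence.from (+-transfer (identityₖ k c k₀ c₀)) (sym (cong₂ (λ u v → 17 * u + 6 * v) hk hc))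
  , Equivalence.from (+-transfer (identity꜀ k c k₀ c₀)) (sym (cong₂ (λ u v → 48 * u + 17 * v) hk hc))
  where
  identityₖ : ∀ k c k₀ c₀ → k + (17 * (k₀ + 6 * c) + 6 * (c₀ + (48 * k + 12)))
                          ≡ (17 * k₀ + 6 * c₀ + 4) + (17 * (17 * k + 4) + 6 * (17 * c))
  identityₖ = solve-∀
  identity꜀ : ∀ k c k₀ c₀ → c + (48 * (k₀ + 6 * c) + 17 * (c₀ + (48 * k + 12)))
                          ≡ (48 * k₀ + 17 * c₀ + 12) + (48 * (17 * k + 4) + 17 * (17 * c))
  identity꜀ = solve-∀

NeoSqrt-descent : ∀ k c → 18 ≤ k → NeoSqrt (suc k) c →
                  ∃₂ λ k₀ c₀ → k₀ < k × NeoSqrt (suc k₀) c₀ × (OnOrbit k₀ c₀ → OnOrbit k c)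
NeoSqrt-descent k c 18≤k h =
  k₀ , c₀ , k₀<k , h₀ , λ on → subst₂ OnOrbit (sym k≡) (sym c≡) (OnOrbit-step on)
  where
  open ≤-Reasoning
  sq : c * c ≡ 8 * (k * k) + 4 * k + 5
  sq = NeoSqrt⇒square k c h
  k₀ c₀ : ℕ
  k₀ = 17 * k + 4 ∸ 6 * c
  c₀ = 17 * c ∸ (48 * k + 12)
  hk : k₀ + 6 * c ≡ 17 * k + 4
  hk = m∸n+n≡m (6c≤17k+4 k c 18≤k sq)
  hc : c₀ + (48 * k + 12) ≡ 17 * c
  hc = m∸n+n≡m (48k+12≤17c k c sq)
  k≡ : k ≡ 17 * k₀ + 6 * c₀ + 4
  k≡ = proj₁ (step-inverse {k} {c} {k₀} {c₀} hk hc)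
  c≡ : c ≡ 48 * k₀ + 17 * c₀ + 12
  c≡ = proj₂ (step-inverse {k} {c} {k₀} {c₀} hk hc)
  h₀ : NeoSqrt (suc k₀) c₀
  h₀ = Equivalence.from (NeoSqrt-step k₀ c₀) (subst₂ (λ k c → NeoSqrt (suc k) c) k≡ c≡ h)
  k₀<k : k₀ < k
  k₀<k = +-cancelʳ-< (6 * c) k₀ k (begin-strict
      k₀ + 6 * c       ≡⟨ hk ⟩
      17 * k + 4       ≡⟨ regroup k ⟩
      k + (16 * k + 4) <⟨ +-monoʳ-< k (16k+4<6c k c sq) ⟩
      k + 6 * c        ∎)
    where
    regroup : ∀ k → 17 * k + 4 ≡ k + (16 * k + 4)
    regroup = solve-∀

NeoSqrt-small : ∀ k c → k ≤ 17 → NeoSqrt (suc k) c → k ≡ 5 × c ≡ 15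
NeoSqrt-small k c k≤17 h =
  subst₂ Solution (toℕ-fromℕ< (s≤s k≤17)) (toℕ-fromℕ< c<54)
    (table (fromℕ< (s≤s k≤17)) (fromℕ< c<54)) h
  where
  Solution : ℕ → ℕ → Set
  Solution k c = NeoSqrt (suc k) c → k ≡ 5 × c ≡ 15
  table : ∀ (i : Fin 18) (j : Fin 54) → Solution (toℕ i) (toℕ j)
  table = toWitness {a? = all? λ i → all? λ j →
    (toℕ j * toℕ j + 12 * suc (toℕ i) ≟ 8 * (suc (toℕ i) * suc (toℕ i)) + 9)
      →-dec ((toℕ i ≟ 5) ×-dec (toℕ j ≟ 15))} _
  c<3k+3 : c * c < (3 * k + 3) * (3 * k + 3)
  c<3k+3 = begin-strict
      c * c                                              ≡⟨ NeoSqrt⇒square k c h ⟩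
      8 * (k * k) + 4 * k + 5                            <⟨ m<m+n _ z<s ⟩
      8 * (k * k) + 4 * k + 5 + suc (k * k + 14 * k + 3) ≡⟨ identity k ⟩
      (3 * k + 3) * (3 * k + 3)                          ∎
    where
    open ≤-Reasoning
    identity : ∀ k → 8 * (k * k) + 4 * k + 5 + suc (k * k + 14 * k + 3) ≡ (3 * k + 3) * (3 * k + 3)
    identity = solve-∀
  c<54 : c < 54
  c<54 = <-≤-trans (m*m<n*n⇒m<n c<3k+3) (+-monoˡ-≤ 3 (*-monoʳ-≤ 3 k≤17))

NeoSqrt⇒OnOrbit : ∀ k c → NeoSqrt (suc k) c → OnOrbit k c
NeoSqrt⇒OnOrbit k c = descend k c (<-wellFounded k)
  where
  descend : ∀ k c → Acc _<_ k → NeoSqrt (suc k) c → OnOrbit k c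
  descend k c (acc rec) h with k ≤? 17
  ... | yes k≤17 = 0 , NeoSqrt-small k c k≤17 h
  ... | no k≰17 = let k₀ , c₀ , k₀<k , h₀ , lift = NeoSqrt-descent k c (≰⇒> k≰17) h
                  in lift (descend k₀ c₀ (rec k₀<k) h₀)

orbit-isNeoBalcobalancer : ∀ t → IsNeoBalcobalancer (B t) (suc (J t))
orbit-isNeoBalcobalancer t =
  s≤s z≤n , s≤s z≤n , Equivalence.from (NeoEq⇔NeoSqrt (K t) (J t)) (NeoSqrt-orbit t)

isNeoBalcobalancer⇒orbit : ∀ {m r} → IsNeoBalcobalancer m r → ∃[ t ] (m ≡ B t × r ≡ suc (J t))
isNeoBalcobalancer⇒orbit {suc k} {suc j} (_ , _ , e) =
  balcobalancer (NeoSqrt⇒OnOrbit k _ (Equivalence.to (NeoEq⇔NeoSqrt k j) e))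
  where
  balcobalancer : OnOrbit k (2 * k + 2 * j + 5) → ∃[ t ] (suc k ≡ B t × suc j ≡ suc (J t))
  balcobalancer (t , refl , c≡) = t , refl , cong suc
    (*-cancelˡ-≡ j (J t) 2 (+-cancelˡ-≡ (2 * K t) _ _ (+-cancelʳ-≡ 5 _ _ c≡)))

enumeratesNeo⇒≗B : ∀ {f} → EnumeratesNeo f → ∀ t → f t ≡ B t
enumeratesNeo⇒≗B {f} (f↑ , enumerates) = same-image⇒≗ f↑ B-strictlyIncreasing f⊆B B⊆f
  where
  f⊆B : ∀ i → ∃[ t ] f i ≡ B t
  f⊆B i = map₂ proj₁ (isNeoBalcobalancer⇒orbit (proj₂ (Equivalence.from (enumerates (f i)) (i , refl))))
  B⊆f : ∀ t → ∃[ i ] B t ≡ f i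
  B⊆f t = map₂ sym (Equivalence.to (enumerates (B t)) (suc (J t) , orbit-isNeoBalcobalancer t))

isNeoBalcobalancer-B⇒≡ : ∀ t {r} → IsNeoBalcobalancer (B t) r → r ≡ suc (J t)
isNeoBalcobalancer-B⇒≡ t {r} h = balcobalancer (isNeoBalcobalancer⇒orbit h)
  where
  balcobalancer : ∃[ t′ ] (B t ≡ B t′ × r ≡ suc (J t′)) → r ≡ suc (J t)
  balcobalancer (t′ , Bt≡Bt′ , r≡) =
    trans r≡ (cong (λ s → suc (J s))
                   (sym (strictlyIncreasing⇒injective B-strictlyIncreasing {t} {t′} Bt≡Bt′)))

-- CR = m - r - 2, where m = d + j + 3 and r = j + 1.
NeoSqrt⇒CR-square : ∀ d j → NeoSqrt (suc (d + j + 2)) (2 * (d + j + 2) + 2 * j + 5) →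
                    d * d ≡ 2 * (suc j * suc j) + 5 * suc j + 2
NeoSqrt⇒CR-square d j h = sym (*-cancelˡ-≡ _ _ 4 (Equivalence.to (+-transfer (identity d j)) h))
  where
  identity : ∀ d j → ((2 * (d + j + 2) + 2 * j + 5) * (2 * (d + j + 2) + 2 * j + 5) + 12 * (1 + (d + j + 2)))
                     + 4 * (d * d)
                   ≡ (8 * ((1 + (d + j + 2)) * (1 + (d + j + 2))) + 9)
                     + 4 * (2 * ((1 + j) * (1 + j)) + 5 * (1 + j) + 2)
  identity = solve-∀

D-square : ∀ t → D t * D t ≡ 2 * (suc (J t) * suc (J t)) + 5 * suc (J t) + 2
D-square t = NeoSqrt⇒CR-square (D t) (J t)
  (subst (λ k → NeoSqrt (suc k) (2 * k + 2 * J t + 5)) (K≡D+J+2 t) (NeoSqrt-orbit t))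

Q-+4 : ∀ x → Q (4 + x) ≡ 12 * Q (1 + x) + 5 * Q x
Q-+4 x = identity (Q (1 + x)) (Q x)
  where
  identity : ∀ u v → 2 * (2 * (2 * u + v) + u) + (2 * u + v) ≡ 12 * u + 5 * v
  identity = solve-∀

-- Both (8 K t + 2, 8 J t + 18) and 3 (Q (4t+3), Q (4t+2)) are multiplied by [[29, 12], [12, 5]] at each step.
KJ-closed : ∀ t → 8 * K t + 2 ≡ 3 * Q (3 + t * 4) × 8 * J t + 18 ≡ 3 * Q (2 + t * 4)
KJ-closed zero = refl , refl
KJ-closed (suc t) = K-step , J-step
  where
  open ≡-Reasoning
  u = Q (3 + t * 4)
  v = Q (2 + t * 4)
  K-step : 8 * K (suc t) + 2 ≡ 3 * Q (3 + suc t * 4)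
  K-step = begin
      8 * (29 * K t + 12 * J t + 34) + 2
    ≡⟨ identity₁ (K t) (J t) ⟩
      29 * (8 * K t + 2) + 12 * (8 * J t + 18)
    ≡⟨ cong₂ (λ a b → 29 * a + 12 * b) (proj₁ (KJ-closed t)) (proj₂ (KJ-closed t)) ⟩
      29 * (3 * u) + 12 * (3 * v)
    ≡⟨ identity₂ u v ⟩
      3 * (12 * (2 * u + v) + 5 * u)
    ≡⟨ cong (3 *_) (sym (Q-+4 (3 + t * 4))) ⟩
      3 * Q (3 + suc t * 4) ∎
    where
    identity₁ : ∀ k j → 8 * (29 * k + 12 * j + 34) + 2 ≡ 29 * (8 * k + 2) + 12 * (8 * j + 18)
    identity₁ = solve-∀
    identity₂ : ∀ u v → 29 * (3 * u) + 12 * (3 * v) ≡ 3 * (12 * (2 * u + v) + 5 * u)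
    identity₂ = solve-∀
  J-step : 8 * J (suc t) + 18 ≡ 3 * Q (2 + suc t * 4)
  J-step = begin
      8 * (12 * K t + 5 * J t + 12) + 18
    ≡⟨ identity₁ (K t) (J t) ⟩
      12 * (8 * K t + 2) + 5 * (8 * J t + 18)
    ≡⟨ cong₂ (λ a b → 12 * a + 5 * b) (proj₁ (KJ-closed t)) (proj₂ (KJ-closed t)) ⟩
      12 * (3 * u) + 5 * (3 * v)
    ≡⟨ identity₂ u v ⟩
      3 * (12 * u + 5 * v)
    ≡⟨ cong (3 *_) (sym (Q-+4 (2 + t * 4))) ⟩
      3 * Q (2 + suc t * 4) ∎
    where
    identity₁ : ∀ k j → 8 * (12 * k + 5 * j + 12) + 18 ≡ 12 * (8 * k + 2) + 5 * (8 * j + 18)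
    identity₁ = solve-∀
    identity₂ : ∀ u v → 12 * (3 * u) + 5 * (3 * v) ≡ 3 * (12 * u + 5 * v)
    identity₂ = solve-∀

D-closed : ∀ t → 8 * D t ≡ 3 * Q (1 + t * 4) + 3 * Q (2 + t * 4)
D-closed t = +-cancelʳ-≡ (3 * Q (2 + t * 4)) _ _ (begin
    8 * D t + 3 * Q (2 + t * 4)
  ≡⟨ cong (8 * D t +_) (sym (proj₂ (KJ-closed t))) ⟩
    8 * D t + (8 * J t + 18)
  ≡⟨ identity₁ (D t) (J t) ⟩
    8 * (D t + J t + 2) + 2
  ≡⟨ cong (λ k → 8 * k + 2) (sym (K≡D+J+2 t)) ⟩
    8 * K t + 2
  ≡⟨ proj₁ (KJ-closed t) ⟩
    3 * Q (3 + t * 4)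
  ≡⟨ identity₂ (Q (2 + t * 4)) (Q (1 + t * 4)) ⟩
    3 * Q (1 + t * 4) + 3 * Q (2 + t * 4) + 3 * Q (2 + t * 4) ∎)
  where
  open ≡-Reasoning
  identity₁ : ∀ d j → 8 * d + (8 * j + 18) ≡ 8 * (d + j + 2) + 2
  identity₁ = solve-∀
  identity₂ : ∀ v w → 3 * (2 * v + w) ≡ 3 * w + 3 * v + 3 * v
  identity₂ = solve-∀

B-closed : ∀ t → 8 * B t ≡ 3 * Q (3 + t * 4) + 6
B-closed t = trans (identity (K t)) (cong (_+ 6) (proj₁ (KJ-closed t)))
  where
  identity : ∀ k → 8 * (1 + k) ≡ 8 * k + 2 + 6
  identity = solve-∀

C-closed : ∀ t c → NeoSqrt (B t) c → 4 * c ≡ 3 * Q (2 + t * 4) + 3 * Q (3 + t * 4)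
C-closed t c h = begin
    4 * c
  ≡⟨ cong (4 *_) (NeoSqrt-unique (B t) c (C t) h (NeoSqrt-orbit t)) ⟩
    4 * (2 * K t + 2 * J t + 5)
  ≡⟨ identity (K t) (J t) ⟩
    (8 * J t + 18) + (8 * K t + 2)
  ≡⟨ cong₂ _+_ (proj₂ (KJ-closed t)) (proj₁ (KJ-closed t)) ⟩
    3 * Q (2 + t * 4) + 3 * Q (3 + t * 4) ∎
  where
  open ≡-Reasoning
  identity : ∀ k j → 4 * (2 * k + 2 * j + 5) ≡ (8 * j + 18) + (8 * k + 2)
  identity = solve-∀

R-closed : ∀ t r → IsNeoBalcobalancer (B t) r → 8 * r + 10 ≡ 3 * Q (2 + t * 4)
R-closed t r h = begin
    8 * r + 10          ≡⟨ cong (λ r → 8 * r + 10) (isNeoBalcobalancer-B⇒≡ t h) ⟩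
    8 * suc (J t) + 10  ≡⟨ identity (J t) ⟩
    8 * J t + 18        ≡⟨ proj₂ (KJ-closed t) ⟩
    3 * Q (2 + t * 4)   ∎
  where
  open ≡-Reasoning
  identity : ∀ j → 8 * (1 + j) + 10 ≡ 8 * j + 18
  identity = solve-∀

CR-closed : ∀ t r cr → IsNeoBalcobalancer (B t) r → cr * cr ≡ 2 * (r * r) + 5 * r + 2 →
            8 * cr ≡ 3 * Q (1 + t * 4) + 3 * Q (2 + t * 4)
CR-closed t r cr h e = trans (cong (8 *_) cr≡D) (D-closed t)
  where
  cr≡D : cr ≡ D t
  cr≡D = m*m≡n*n⇒m≡n {cr} {D t}
    (trans e (trans (cong (λ r → 2 * (r * r) + 5 * r + 2) (isNeoBalcobalancer-B⇒≡ t h)) (sym (D-square t))))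

-- The paper's basis: Q (4 + x) and Q (3 + x) are Q (4n - 4) and Q (4n - 5) for x = 4n - 8.

Q₇-basis : ∀ x → 3 * Q (7 + x) ≡ 36 * Q (4 + x) + 15 * Q (3 + x)
Q₇-basis x = trans (cong (3 *_) (Q-+4 (3 + x))) (identity (Q (4 + x)) (Q (3 + x)))
  where
  identity : ∀ a b → 3 * (12 * a + 5 * b) ≡ 36 * a + 15 * b
  identity = solve-∀

Q₆-basis : ∀ x → 3 * Q (6 + x) ≡ 15 * Q (4 + x) + 6 * Q (3 + x)
Q₆-basis x = identity (Q (4 + x)) (Q (3 + x))
  where
  identity : ∀ a b → 3 * (2 * (2 * a + b) + a) ≡ 15 * a + 6 * b
  identity = solve-∀

Q₅-basis : ∀ x → 3 * Q (5 + x) ≡ 6 * Q (4 + x) + 3 * Q (3 + x)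
Q₅-basis x = identity (Q (4 + x)) (Q (3 + x))
  where
  identity : ∀ a b → 3 * (2 * a + b) ≡ 6 * a + 3 * b
  identity = solve-∀

4[2+q]∸4 : ∀ q → 4 * suc (suc q) ∸ 4 ≡ 4 + q * 4
4[2+q]∸4 q = cong (_∸ 4) (identity q)
  where
  identity : ∀ q → 4 * (2 + q) ≡ 8 + q * 4
  identity = solve-∀

4[2+q]∸5 : ∀ q → 4 * suc (suc q) ∸ 5 ≡ 3 + q * 4
4[2+q]∸5 q = cong (_∸ 5) (identity q)
  where
  identity : ∀ q → 4 * (2 + q) ≡ 8 + q * 4
  identity = solve-∀

theorem5p2 : (f : ℕ → ℕ) → EnumeratesNeo f → (n : ℕ) → 2 ≤ n →
      (8 * f (n ∸ 1) ≡ 36 * Q (4 * n ∸ 4) + 15 * Q (4 * n ∸ 5) + 6)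
    × (∀ c → c * c + 12 * f (n ∸ 1) ≡ 8 * (f (n ∸ 1) * f (n ∸ 1)) + 9 →
         4 * c ≡ 51 * Q (4 * n ∸ 4) + 21 * Q (4 * n ∸ 5))
    × (∀ r → IsNeoBalcobalancer (f (n ∸ 1)) r →
         8 * r + 10 ≡ 15 * Q (4 * n ∸ 4) + 6 * Q (4 * n ∸ 5))
    × (∀ r cr → IsNeoBalcobalancer (f (n ∸ 1)) r →
         cr * cr ≡ 2 * (r * r) + 5 * r + 2 →
         8 * cr ≡ 21 * Q (4 * n ∸ 4) + 9 * Q (4 * n ∸ 5))
theorem5p2 f en (suc (suc q)) (s≤s (s≤s z≤n)) rewrite 4[2+q]∸4 q | 4[2+q]∸5 q =
    trans (cong (8 *_) fₜ≡Bₜ) (trans (B-closed t) (cong (_+ 6) (Q₇-basis x)))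
  , (λ c h → trans (C-closed t c (subst (λ m → NeoSqrt m c) fₜ≡Bₜ h))
                   (trans (cong₂ _+_ (Q₆-basis x) (Q₇-basis x)) (identity₁ a b)))
  , (λ r h → trans (R-closed t r (subst (λ m → IsNeoBalcobalancer m r) fₜ≡Bₜ h)) (Q₆-basis x))
  , (λ r cr h e → trans (CR-closed t r cr (subst (λ m → IsNeoBalcobalancer m r) fₜ≡Bₜ h) e)
                        (trans (cong₂ _+_ (Q₅-basis x) (Q₆-basis x)) (identity₂ a b)))
  where
  t = suc q
  fₜ≡Bₜ : f t ≡ B t
  fₜ≡Bₜ = enumeratesNeo⇒≗B en t
  x = q * 4
  a = Q (4 + x)
  b = Q (3 + x)
  identity₁ : ∀ a b → (15 * a + 6 * b) + (36 * a + 15 * b) ≡ 51 * a + 21 * b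
  identity₁ = solve-∀
  identity₂ : ∀ a b → (6 * a + 3 * b) + (15 * a + 6 * b) ≡ 21 * a + 9 * b
  identity₂ = solve-∀
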